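{- The class of balanced rotor types and the class of ab-ba rotor types are each closed under $UU$, $UD$, $DU$, and $DD$.
   Context: A rotor type is an infinite periodic sequence $r=(r^{(1)},r^{(2)},\dots)$ of states with fundamental period $|r|$. A two-state rotor type is written over $\{1,2\}$ (convention $r^{(1)}=1$); it is balanced if $1$ and $2$ occur equally often in a period; it is ab-ba ($2$-balanced) if $|r|$ is even and for every $k\ge0$ the pair $r^{(2k+1)},r^{(2k+2)}$ consists of one $1$ and one $2$. Rotor-router dynamics: at each non-target vertex $v$ there is a periodic sequence $e_v^{(1)},e_v^{(2)},\dots$ of out-edges; a particle starts at the source, on its $n$-th visit to a non-target vertex $v$ leaves along $e_v^{(n)}$, and whenever it reaches a target it is returned to the source; the hitting sequence is the (periodic) sequence of targets reached. The compressor for $r$ has non-target vertices $1$ (source), $2,3$ and targets $4,5$. On the $j$-th departure: from vertex $1$ the particle goes to vertex $2$ if $r^{(j)}=1$ and to vertex $3$ if $r^{(j)}=2$; from vertex $2$, in variant $U$ it goes to vertex $1$ if $r^{(j)}=1$ and to target $4$ if $r^{(j)}=2$, in variant $D$ to target $4$ if $r^{(j)}=1$ and to vertex $1$ if $r^{(j)}=2$; from vertex $3$ likewise with target $5$. For $X,Y\in\{U,D\}$, $XY(r)$ is the hitting sequence with variant $X$ at vertex $2$ and $Y$ at vertex $3$, viewed as a rotor type with $4$ written as $1$ and $5$ as $2$. -}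

module Defs where

open import Data.Nat using (ℕ; zero; suc; _+_; _*_; _<_; _≤_)
open import Data.Product using (Σ; _×_; _,_; ∃; ∃-syntax)
open import Relation.Binary.PropositionalEquality using (_≡_; _≢_)

data St : Set where
  s1 s2 : St

-- Sequences are 0-indexed: r 0 is r^(1), r j is r^(j+1).
Seq : Set
Seq = ℕ → St

IsPeriod : Seq → ℕ → Set
IsPeriod r p = 0 < p × (∀ n → r (p + n) ≡ r n)

IsFundamentalPeriod : Seq → ℕ → Set
IsFundamentalPeriod r p = IsPeriod r p × (∀ q → IsPeriod r q → p ≤ q)

RotorType : Seq → Set
RotorType r = ∃[ p ] IsPeriod r p

count : St → Seq → ℕ → ℕ
count s r zero = zero
count s1 r (suc n) with r n
... | s1 = suc (count s1 r n)
... | s2 = count s1 r n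
count s2 r (suc n) with r n
... | s1 = count s2 r n
... | s2 = suc (count s2 r n)

Balanced : Seq → Set
Balanced r = ∃[ p ] (IsFundamentalPeriod r p × count s1 r p ≡ count s2 r p)

AbBa : Seq → Set
AbBa r = ∃[ p ] (IsFundamentalPeriod r p × (∃[ m ] p ≡ 2 * m)
                 × (∀ k → r (2 * k) ≢ r (suc (2 * k))))

data Variant : Set where
  U D : Variant

-- non-target vertices 1 (source), 2, 3
data Vtx : Set where
  v1 v2 v3 : Vtx

data Out : Set where
  go   : Vtx → Out
  hit4 hit5 : Out

-- departure from vertex 2 (target t = hit4) or 3 (target t = hit5)
-- under variant X with rotor state s
sideMove : Variant → Out → St → Out
sideMove U t s1 = go v1
sideMove U t s2 = t
sideMove D t s1 = t
sideMove D t s2 = go v1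

-- configuration: current vertex and number of departures so far from 1, 2, 3
record Config : Set where
  constructor cfg
  field
    pos : Vtx
    n1 n2 n3 : ℕ

initial : Config
initial = cfg v1 0 0 0

-- the vertex the particle occupies after a departure
-- (after reaching a target it is returned to the source)
nextPos : Out → Vtx
nextPos (go w) = w
nextPos hit4 = v1
nextPos hit5 = v1

-- one departure: on the j-th departure from a vertex (j = count + 1)
-- the rotor state used is r^(j) = r count
stepOut : Variant → Variant → Seq → Config → Out
stepOut X Y r (cfg v1 a b c) with r a
... | s1 = go v2
... | s2 = go v3
stepOut X Y r (cfg v2 a b c) = sideMove X hit4 (r b)
stepOut X Y r (cfg v3 a b c) = sideMove Y hit5 (r c)

stepCfg : Variant → Variant → Seq → Config → Config
stepCfg X Y r k@(cfg v1 a b c) = cfg (nextPos (stepOut X Y r k)) (suc a) b c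
stepCfg X Y r k@(cfg v2 a b c) = cfg (nextPos (stepOut X Y r k)) a (suc b) c
stepCfg X Y r k@(cfg v3 a b c) = cfg (nextPos (stepOut X Y r k)) a b (suc c)

config : Variant → Variant → Seq → ℕ → Config
config X Y r zero = initial
config X Y r (suc n) = stepCfg X Y r (config X Y r n)

out : Variant → Variant → Seq → ℕ → Out
out X Y r n = stepOut X Y r (config X Y r n)

hitsBefore : Variant → Variant → Seq → ℕ → ℕ
hitsBefore X Y r zero = zero
hitsBefore X Y r (suc n) with out X Y r n
... | go _ = hitsBefore X Y r n
... | hit4 = suc (hitsBefore X Y r n)
... | hit5 = suc (hitsBefore X Y r n)

-- h is the hitting sequence XY(r) (target 4 written as 1, 5 as 2):
-- targets are hit infinitely often, and the k-th target hit
-- (0-indexed) is h k.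
IsHittingSeq : Variant → Variant → Seq → Seq → Set
IsHittingSeq X Y r h =
  (∀ k → ∃[ n ] k < hitsBefore X Y r n)
  × (∀ n → out X Y r n ≡ hit4 → h (hitsBefore X Y r n) ≡ s1)
  × (∀ n → out X Y r n ≡ hit5 → h (hitsBefore X Y r n) ≡ s2)

-- The departures of the particle come in rounds of two: from vertex 1 to vertex 2 or 3
-- according to r n, then back to vertex 1 or to a target; so the hitting sequence h is
-- that of the stream of round outcomes. If r has period p containing c ones and c twos
-- (p = 2c), the rounds repeat after 2p rounds, during which vertices 2 and 3 are each left
-- p times and each hit their target c times; so h has period p with c ones and c twos.
-- Comparing the counts over p·q for the fundamental period q of h shows that q also
-- contains equally many ones and twos.
-- If r is ab-ba, the rounds 2k and 2k + 1 visit vertices 2 and 3 once each, both with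
-- rotor state r k. For UU and DD both or neither hit, giving a pair of distinct targets;
-- for UD and DU exactly one hits, and h is r or its complement. Either way the pairs of h
-- differ, which makes count s1 h (2q) = q, so any period q of h equals 2 · count s1 h q.

module Submission where

open import Data.Empty using (⊥-elim)
open import Data.Fin using (toℕ; fromℕ<)
open import Data.Fin.Properties using (all?; toℕ-fromℕ<)
open import Data.Nat hiding (parity)
open import Data.Nat.DivMod using (_%_; _/_; m≡m%n+[m/n]*n; m%n<n)
open import Data.Nat.Properties
open import Algebra.Properties.CommutativeSemigroup +-commutativeSemigroup
  using (interchange; x∙yz≈y∙xz)
open import Data.Product using (_×_; _,_; ∃-syntax; proj₁; proj₂)
open import Data.Sum using (_⊎_; inj₁; inj₂; [_,_]′)
open import Function using (_∘_)
open import Relation.Binary.Definitions using (tri<; tri≈; tri>)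
open import Relation.Binary.PropositionalEquality
open import Relation.Nullary using (¬_; Dec; yes; no)

open import Defs

open ≡-Reasoning

_≟ₛ_ : (s t : St) → Dec (s ≡ t)
s1 ≟ₛ s1 = yes refl
s1 ≟ₛ s2 = no λ ()
s2 ≟ₛ s1 = no λ ()
s2 ≟ₛ s2 = yes refl

flip : St → St
flip s1 = s2
flip s2 = s1

≢⇒≡flip : ∀ {s t} → s ≢ t → t ≡ flip s
≢⇒≡flip {s1} {s1} s≢t = ⊥-elim (s≢t refl)
≢⇒≡flip {s1} {s2} _   = refl
≢⇒≡flip {s2} {s1} _   = refl
≢⇒≡flip {s2} {s2} s≢t = ⊥-elim (s≢t refl)

δ : St → St → ℕ
δ s1 s1 = 1
δ s2 s2 = 1
δ _  _  = 0

δ-flip : ∀ s t → δ s t + δ s (flip t) ≡ 1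
δ-flip s1 s1 = refl
δ-flip s1 s2 = refl
δ-flip s2 s1 = refl
δ-flip s2 s2 = refl

δ-flip-self : ∀ s → δ (flip s) s ≡ 0
δ-flip-self s1 = refl
δ-flip-self s2 = refl

∑< : (ℕ → ℕ) → ℕ → ℕ
∑< f zero    = 0
∑< f (suc n) = f n + ∑< f n

Periodic : {A : Set} → (ℕ → A) → ℕ → Set
Periodic f q = ∀ n → f (q + n) ≡ f n

module _ {A : Set} {f : ℕ → A} where

  periodic-+ : ∀ {p q} → Periodic f p → Periodic f q → Periodic f (p + q)
  periodic-+ {p} {q} fp fq n = trans (cong f (+-assoc p q n)) (trans (fp (q + n)) (fq n))

  periodic-* : ∀ {q} → Periodic f q → ∀ k → Periodic f (k * q)
  periodic-* fq zero    n = refl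
  periodic-* fq (suc k) = periodic-+ fq (periodic-* fq k)

  periodic-from-prefix : ∀ {P q} → 0 < P → Periodic f P →
                         (∀ n → n < P → f (q + n) ≡ f n) → Periodic f q
  periodic-from-prefix {P} {q} P>0 fP prefix n = begin
    f (q + n)                        ≡⟨ cong (λ m → f (q + m)) n≡ ⟩
    f (q + (n / P * P + n % P))      ≡⟨ cong f (x∙yz≈y∙xz q (n / P * P) (n % P)) ⟩
    f (n / P * P + (q + n % P))      ≡⟨ periodic-* fP (n / P) (q + n % P) ⟩
    f (q + n % P)                    ≡⟨ prefix (n % P) (m%n<n n P) ⟩
    f (n % P)                        ≡⟨ periodic-* fP (n / P) (n % P) ⟨
    f (n / P * P + n % P)            ≡⟨ cong f n≡ ⟨
    f n                              ∎
    where
    instance _ = >-nonZero P>0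
    n≡ : n ≡ n / P * P + n % P
    n≡ = trans (m≡m%n+[m/n]*n n P) (+-comm (n % P) (n / P * P))

module _ {f : ℕ → ℕ} where

  ∑<-+ : ∀ {q} → Periodic f q → ∀ n → ∑< f (q + n) ≡ ∑< f q + ∑< f n
  ∑<-+ {q} fq zero    = trans (cong (∑< f) (+-identityʳ q)) (sym (+-identityʳ _))
  ∑<-+ {q} fq (suc n) = begin
    ∑< f (q + suc n)               ≡⟨ cong (∑< f) (+-suc q n) ⟩
    f (q + n) + ∑< f (q + n)       ≡⟨ cong₂ _+_ (fq n) (∑<-+ fq n) ⟩
    f n + (∑< f q + ∑< f n)        ≡⟨ x∙yz≈y∙xz (f n) (∑< f q) (∑< f n) ⟩
    ∑< f q + ∑< f (suc n)          ∎

  ∑<-* : ∀ {q} → Periodic f q → ∀ k → ∑< f (k * q) ≡ k * ∑< f q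
  ∑<-* fq zero    = refl
  ∑<-* {q} fq (suc k) = trans (∑<-+ fq (k * q)) (cong (∑< f q +_) (∑<-* fq k))

count-suc : ∀ s (r : Seq) n → count s r (suc n) ≡ δ s (r n) + count s r n
count-suc s1 r n with r n
... | s1 = refl
... | s2 = refl
count-suc s2 r n with r n
... | s1 = refl
... | s2 = refl

count≡∑< : ∀ s (r : Seq) n → count s r n ≡ ∑< (δ s ∘ r) n
count≡∑< s r zero    = refl
count≡∑< s r (suc n) = trans (count-suc s r n) (cong (δ s (r n) +_) (count≡∑< s r n))

count-s1+count-s2 : ∀ (r : Seq) n → count s1 r n + count s2 r n ≡ n
count-s1+count-s2 r zero    = refl
count-s1+count-s2 r (suc n) = begin
  count s1 r (suc n) + count s2 r (suc n)
    ≡⟨ cong₂ _+_ (count-suc s1 r n) (count-suc s2 r n) ⟩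
  (δ s1 (r n) + count s1 r n) + (δ s2 (r n) + count s2 r n)
    ≡⟨ interchange (δ s1 (r n)) (count s1 r n) (δ s2 (r n)) (count s2 r n) ⟩
  (δ s1 (r n) + δ s2 (r n)) + (count s1 r n + count s2 r n)
    ≡⟨ cong₂ _+_ (δ-s1+δ-s2 (r n)) (count-s1+count-s2 r n) ⟩
  suc n ∎
  where
  δ-s1+δ-s2 : ∀ t → δ s1 t + δ s2 t ≡ 1
  δ-s1+δ-s2 s1 = refl
  δ-s1+δ-s2 s2 = refl

module _ {r : Seq} {q : ℕ} (rq : Periodic r q) where

  count-+ : ∀ s n → count s r (q + n) ≡ count s r q + count s r n
  count-+ s n = begin
    count s r (q + n)                      ≡⟨ count≡∑< s r (q + n) ⟩
    ∑< (δ s ∘ r) (q + n)                   ≡⟨ ∑<-+ (cong (δ s) ∘ rq) n ⟩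
    ∑< (δ s ∘ r) q + ∑< (δ s ∘ r) n        ≡⟨ cong₂ _+_ (count≡∑< s r q) (count≡∑< s r n) ⟨
    count s r q + count s r n              ∎

  count-* : ∀ s k → count s r (k * q) ≡ k * count s r q
  count-* s k = begin
    count s r (k * q)        ≡⟨ count≡∑< s r (k * q) ⟩
    ∑< (δ s ∘ r) (k * q)     ≡⟨ ∑<-* (cong (δ s) ∘ rq) k ⟩
    k * ∑< (δ s ∘ r) q       ≡⟨ cong (k *_) (count≡∑< s r q) ⟨
    k * count s r q          ∎

AbBaPairs : Seq → Set
AbBaPairs r = ∀ k → r (2 * k) ≢ r (suc (2 * k))

count-abBaPairs : ∀ {r} → AbBaPairs r → ∀ s k → count s r (2 * k) ≡ k
count-abBaPairs         pairs s zero    = refl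
count-abBaPairs {r} pairs s (suc k) = begin
  count s r (2 * suc k)                                ≡⟨ cong (count s r) (*-suc 2 k) ⟩
  count s r (suc (suc (2 * k)))                        ≡⟨ count-suc s r (suc (2 * k)) ⟩
  δ s b + count s r (suc (2 * k))                      ≡⟨ cong (δ s b +_) (count-suc s r (2 * k)) ⟩
  δ s b + (δ s a + count s r (2 * k))                  ≡⟨ x∙yz≈y∙xz (δ s b) (δ s a) _ ⟩
  δ s a + (δ s b + count s r (2 * k))                  ≡⟨ +-assoc (δ s a) (δ s b) _ ⟨
  (δ s a + δ s b) + count s r (2 * k)
    ≡⟨ cong₂ _+_ (trans (cong (λ t → δ s a + δ s t) (≢⇒≡flip (pairs k))) (δ-flip s a))
                 (count-abBaPairs pairs s k) ⟩
  suc k                                                ∎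
  where
  a = r (2 * k)
  b = r (suc (2 * k))

module _ {P : ℕ → Set} (P? : ∀ n → Dec (P n)) where

  private
    Least : ℕ → Set
    Least m = P m × (∀ k → P k → m ≤ k)

    search : ∀ n → ∃[ m ] Least m ⊎ (∀ k → k < n → ¬ P k)
    search zero = inj₂ λ _ ()
    search (suc n) with search n
    ... | inj₁ least = inj₁ least
    ... | inj₂ none with P? n
    ...   | yes Pn = inj₁ (n , Pn , λ k Pk → ≮⇒≥ λ k<n → none k k<n Pk)
    ...   | no ¬Pn = inj₂ λ k k<1+n →
                       [ (λ k<n → none k k<n) , (λ { refl → ¬Pn }) ]′ (m<1+n⇒m<n∨m≡n k<1+n)

  least-witness : ∀ {n} → P n → ∃[ m ] (P m × (∀ k → P k → m ≤ k))
  least-witness {n} Pn with search (suc n)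
  ... | inj₁ least = least
  ... | inj₂ none  = ⊥-elim (none n ≤-refl Pn)

isPeriod? : ∀ {h P} → IsPeriod h P → ∀ q → Dec (IsPeriod h q)
isPeriod? {h} {P} (P>0 , hP) q with 0 <? q | all? {n = P} (λ i → h (q + toℕ i) ≟ₛ h (toℕ i))
... | no q≯0  | _           = no (q≯0 ∘ proj₁)
... | yes _   | no ¬prefix  = no λ (_ , hq) → ¬prefix (hq ∘ toℕ)
... | yes q>0 | yes prefix  = yes (q>0 , periodic-from-prefix P>0 hP prefix′)
  where
  prefix′ : ∀ n → n < P → h (q + n) ≡ h n
  prefix′ n n<P = subst (λ m → h (q + m) ≡ h m) (toℕ-fromℕ< n<P) (prefix (fromℕ< n<P))

fundamentalPeriod : ∀ {h P} → IsPeriod h P → ∃[ q ] IsFundamentalPeriod h q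
fundamentalPeriod per = least-witness (isPeriod? per) per

balanced-of-period : ∀ {h P} → IsPeriod h P → count s1 h P ≡ count s2 h P → Balanced h
balanced-of-period {h} {P} per@(P>0 , hP) eq with fundamentalPeriod per
... | q , fund@((_ , hq) , _) = q , fund , *-cancelˡ-≡ _ _ P (begin
  P * count s1 h q   ≡⟨ count-proportional s1 ⟨
  q * count s1 h P   ≡⟨ cong (q *_) eq ⟩
  q * count s2 h P   ≡⟨ count-proportional s2 ⟩
  P * count s2 h q   ∎)
  where
  instance _ = >-nonZero P>0
  count-proportional : ∀ s → q * count s h P ≡ P * count s h q
  count-proportional s = begin
    q * count s h P    ≡⟨ count-* hP s q ⟨
    count s h (q * P)  ≡⟨ cong (count s h) (*-comm q P) ⟩
    count s h (P * q)  ≡⟨ count-* hq s P ⟩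
    P * count s h q    ∎

balanced-of-abBa : ∀ {r} → AbBa r → Balanced r
balanced-of-abBa {r} (p , fund , (m , p≡2m) , pairs) =
  p , fund , trans (half s1) (sym (half s2))
  where
  half : ∀ s → count s r p ≡ m
  half s = trans (cong (count s r) p≡2m) (count-abBaPairs pairs s m)

abBa-of-balanced : ∀ {h} → Balanced h → AbBaPairs h → AbBa h
abBa-of-balanced {h} (q , fund@((_ , hq) , _) , _) pairs =
  q , fund , (count s1 h q , trans (sym (count-abBaPairs pairs s1 q)) (count-* hq s1 2)) , pairs

isHit : Out → ℕ
isHit (go _) = 0
isHit hit4   = 1
isHit hit5   = 1

-- label is only meaningful on hits; label (go _) = s1 is junk.
label : Out → St
label hit5 = s2
label _    = s1

isHitOf : St → Out → ℕ
isHitOf _  (go _) = 0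
isHitOf s1 hit4   = 1
isHitOf s2 hit4   = 0
isHitOf s1 hit5   = 0
isHitOf s2 hit5   = 1

isHit-miss⊎hit : ∀ x → isHit x ≡ 0 ⊎ isHit x ≡ 1
isHit-miss⊎hit (go _) = inj₁ refl
isHit-miss⊎hit hit4   = inj₂ refl
isHit-miss⊎hit hit5   = inj₂ refl

isHit≡isHitOf-s1+isHitOf-s2 : ∀ x → isHit x ≡ isHitOf s1 x + isHitOf s2 x
isHit≡isHitOf-s1+isHitOf-s2 (go _) = refl
isHit≡isHitOf-s1+isHitOf-s2 hit4   = refl
isHit≡isHitOf-s1+isHitOf-s2 hit5   = refl

isHitOf-miss : ∀ s x → isHit x ≡ 0 → isHitOf s x ≡ 0
isHitOf-miss s (go _) _ = refl

δ-label : ∀ s x → isHit x ≡ 1 → δ s (label x) ≡ isHitOf s x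
δ-label s1 hit4 _ = refl
δ-label s2 hit4 _ = refl
δ-label s1 hit5 _ = refl
δ-label s2 hit5 _ = refl

hits : (ℕ → Out) → ℕ → ℕ
hits o = ∑< (isHit ∘ o)

hitsOf : St → (ℕ → Out) → ℕ → ℕ
hitsOf s o = ∑< (isHitOf s ∘ o)

HitsUnbounded : (ℕ → Out) → Set
HitsUnbounded o = ∀ k → ∃[ n ] k < hits o n

record IsHitSubsequence (o : ℕ → Out) (h : Seq) : Set where
  field
    unbounded : HitsUnbounded o
    at-hit    : ∀ n → isHit (o n) ≡ 1 → h (hits o n) ≡ label (o n)

module _ {o : ℕ → Out} where

  hits-< : ∀ {m n} → isHit (o m) ≡ 1 → m < n → hits o m < hits o n
  hits-< {m} {suc n} hit m<1+n with m<1+n⇒m<n∨m≡n m<1+n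
  ... | inj₁ m<n  = <-≤-trans (hits-< hit m<n) (m≤n+m _ _)
  ... | inj₂ refl = subst (λ i → hits o m < i + hits o m) (sym hit) ≤-refl

  hits-injective : ∀ {m n} → isHit (o m) ≡ 1 → isHit (o n) ≡ 1 → hits o m ≡ hits o n → m ≡ n
  hits-injective {m} {n} hm hn eq with <-cmp m n
  ... | tri< m<n _ _ = ⊥-elim (<⇒≢ (hits-< hm m<n) eq)
  ... | tri≈ _ m≡n _ = m≡n
  ... | tri> _ _ n<m = ⊥-elim (<⇒≢ (hits-< hn n<m) (sym eq))

  hit-numbered : ∀ {k} n → k < hits o n → ∃[ m ] (hits o m ≡ k × isHit (o m) ≡ 1)
  hit-numbered {k} (suc n) k<hits with isHit-miss⊎hit (o n)
  ... | inj₁ miss = hit-numbered n (subst (λ i → k < i + hits o n) miss k<hits)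
  ... | inj₂ hit with m<1+n⇒m<n∨m≡n (subst (λ i → k < i + hits o n) hit k<hits)
  ...   | inj₁ k<  = hit-numbered n k<
  ...   | inj₂ refl = n , refl , hit

  hitSubsequence : HitsUnbounded o → ∃[ h ] IsHitSubsequence o h
  hitSubsequence unb = h , record { unbounded = unb ; at-hit = at-hit }
    where
    position : ∀ k → ∃[ m ] (hits o m ≡ k × isHit (o m) ≡ 1)
    position k = hit-numbered (proj₁ (unb k)) (proj₂ (unb k))

    h : Seq
    h k = label (o (proj₁ (position k)))

    at-hit : ∀ n → isHit (o n) ≡ 1 → h (hits o n) ≡ label (o n)
    at-hit n hn with position (hits o n)
    ... | m , eq , hm = cong (label ∘ o) (hits-injective hm hn eq)

  hits-split : ∀ n → hits o n ≡ hitsOf s1 o n + hitsOf s2 o n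
  hits-split zero    = refl
  hits-split (suc n) = begin
    isHit (o n) + hits o n
      ≡⟨ cong₂ _+_ (isHit≡isHitOf-s1+isHitOf-s2 (o n)) (hits-split n) ⟩
    (isHitOf s1 (o n) + isHitOf s2 (o n)) + (hitsOf s1 o n + hitsOf s2 o n)
      ≡⟨ interchange (isHitOf s1 (o n)) _ _ _ ⟩
    hitsOf s1 o (suc n) + hitsOf s2 o (suc n) ∎

  periodic-hitsUnbounded : ∀ {N} → Periodic o N → 0 < hits o N → HitsUnbounded o
  periodic-hitsUnbounded {N} oN pos zero    = N , pos
  periodic-hitsUnbounded {N} oN pos (suc k) with periodic-hitsUnbounded oN pos k
  ... | n , k<hits = N + n , subst (suc k <_) (sym (∑<-+ (cong isHit ∘ oN) n)) (+-mono-≤ pos k<hits)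

  module _ {h : Seq} (hs : IsHitSubsequence o h) where
    open IsHitSubsequence hs

    every-index-hit : ∀ k → ∃[ m ] (hits o m ≡ k × isHit (o m) ≡ 1)
    every-index-hit k = hit-numbered (proj₁ (unbounded k)) (proj₂ (unbounded k))

    hitSubsequence-periodic : ∀ {N} → Periodic o N → Periodic h (hits o N)
    hitSubsequence-periodic {N} oN k with every-index-hit k
    ... | n , refl , hn = begin
      h (hits o N + hits o n)  ≡⟨ cong h (∑<-+ (cong isHit ∘ oN) n) ⟨
      h (hits o (N + n))       ≡⟨ at-hit (N + n) (trans (cong isHit (oN n)) hn) ⟩
      label (o (N + n))        ≡⟨ cong label (oN n) ⟩
      label (o n)              ≡⟨ at-hit n hn ⟨
      h (hits o n)             ∎

    count-hitSubsequence : ∀ s n → count s h (hits o n) ≡ hitsOf s o n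
    count-hitSubsequence s zero    = refl
    count-hitSubsequence s (suc n) with isHit-miss⊎hit (o n)
    ... | inj₁ miss = begin
      count s h (isHit (o n) + hits o n)  ≡⟨ cong (λ i → count s h (i + hits o n)) miss ⟩
      count s h (hits o n)                ≡⟨ count-hitSubsequence s n ⟩
      hitsOf s o n                        ≡⟨ cong (_+ hitsOf s o n) (isHitOf-miss s (o n) miss) ⟨
      hitsOf s o (suc n)                  ∎
    ... | inj₂ hit = begin
      count s h (isHit (o n) + hits o n)           ≡⟨ cong (λ i → count s h (i + hits o n)) hit ⟩
      count s h (suc (hits o n))                   ≡⟨ count-suc s h (hits o n) ⟩
      δ s (h (hits o n)) + count s h (hits o n)
        ≡⟨ cong₂ _+_ (cong (δ s) (at-hit n hit)) (count-hitSubsequence s n) ⟩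
      δ s (label (o n)) + hitsOf s o n             ≡⟨ cong (_+ hitsOf s o n) (δ-label s (o n) hit) ⟩
      hitsOf s o (suc n)                           ∎

data Parity : ℕ → Set where
  even : ∀ k → Parity (2 * k)
  odd  : ∀ k → Parity (suc (2 * k))

parity : ∀ n → Parity n
parity zero = even 0
parity (suc n) with parity n
... | even k = odd k
... | odd k  = subst Parity (*-suc 2 k) (even (suc k))

module _ {o o′ : ℕ → Out} {h : Seq} (hs : IsHitSubsequence o h)
         (even-miss : ∀ n → isHit (o′ (2 * n)) ≡ 0) (odd-o : ∀ n → o′ (suc (2 * n)) ≡ o n) where
  open IsHitSubsequence hs

  private
    hits-even : ∀ n → hits o′ (2 * n) ≡ hits o n
    hits-even zero    = refl
    hits-even (suc n) = begin
      hits o′ (2 * suc n)                                          ≡⟨ cong (hits o′) (*-suc 2 n) ⟩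
      isHit (o′ (suc (2 * n))) + (isHit (o′ (2 * n)) + hits o′ (2 * n))
        ≡⟨ cong₂ _+_ (cong isHit (odd-o n)) (cong₂ _+_ (even-miss n) (hits-even n)) ⟩
      hits o (suc n)                                               ∎

  hitSubsequence-interleave : IsHitSubsequence o′ h
  hitSubsequence-interleave = record { unbounded = unbounded′ ; at-hit = at-hit′ }
    where
    unbounded′ : HitsUnbounded o′
    unbounded′ k with unbounded k
    ... | n , k<hits = 2 * n , subst (k <_) (sym (hits-even n)) k<hits

    at-hit′ : ∀ n → isHit (o′ n) ≡ 1 → h (hits o′ n) ≡ label (o′ n)
    at-hit′ n hit with parity n
    ... | even k = ⊥-elim (0≢1+n (trans (sym (even-miss k)) hit))
    ... | odd k  = begin
      h (isHit (o′ (2 * k)) + hits o′ (2 * k))  ≡⟨ cong h (cong₂ _+_ (even-miss k) (hits-even k)) ⟩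
      h (hits o k)                               ≡⟨ at-hit k (trans (cong isHit (sym (odd-o k))) hit) ⟩
      label (o k)                                ≡⟨ cong label (odd-o k) ⟨
      label (o′ (suc (2 * k)))                   ∎

data PairedBlock : Out → Out → Set where
  misses : ∀ {a b} → isHit a ≡ 0 → isHit b ≡ 0 → PairedBlock a b
  paired : ∀ {a b} → isHit a ≡ 1 → isHit b ≡ 1 → label a ≢ label b → PairedBlock a b

data SingleHitBlock (s : St) : Out → Out → Set where
  first  : ∀ {a b} → isHit a ≡ 1 → label a ≡ s → isHit b ≡ 0 → SingleHitBlock s a b
  second : ∀ {a b} → isHit a ≡ 0 → isHit b ≡ 1 → label b ≡ s → SingleHitBlock s a b

module _ {o : ℕ → Out} (blocks : ∀ k → PairedBlock (o (2 * k)) (o (suc (2 * k)))) where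

  hits-pairedBlocks : ∀ k → ∃[ i ] hits o (2 * k) ≡ 2 * i
  hits-pairedBlocks zero    = 0 , refl
  hits-pairedBlocks (suc k) with hits-pairedBlocks k | blocks k
  ... | i , eq | misses miss₁ miss₂ = i , (begin
    hits o (2 * suc k)                                            ≡⟨ cong (hits o) (*-suc 2 k) ⟩
    isHit (o (suc (2 * k))) + (isHit (o (2 * k)) + hits o (2 * k)) ≡⟨ cong₂ _+_ miss₂ (cong₂ _+_ miss₁ eq) ⟩
    2 * i                                                         ∎)
  ... | i , eq | paired hit₁ hit₂ _ = suc i , (begin
    hits o (2 * suc k)                                            ≡⟨ cong (hits o) (*-suc 2 k) ⟩
    isHit (o (suc (2 * k))) + (isHit (o (2 * k)) + hits o (2 * k)) ≡⟨ cong₂ _+_ hit₂ (cong₂ _+_ hit₁ eq) ⟩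
    suc (suc (2 * i))                                             ≡⟨ *-suc 2 i ⟨
    2 * suc i                                                     ∎)

  odd-hit-odd-number : ∀ k j → isHit (o (suc (2 * k))) ≡ 1 → hits o (suc (2 * k)) ≢ 2 * j
  odd-hit-odd-number k j hit hits≡2j with blocks k | hits-pairedBlocks k
  ... | misses _ miss      | _           = 0≢1+n (trans (sym miss) hit)
  ... | paired hit₁ _ _    | i , hits≡2i = even≢odd j i (trans (sym hits≡2j) (cong₂ _+_ hit₁ hits≡2i))

  abBaPairs-of-pairedBlocks : ∀ {h} → IsHitSubsequence o h → AbBaPairs h
  abBaPairs-of-pairedBlocks {h} hs j h2j≡h2j+1 with every-index-hit hs (2 * j)
  ... | m , hits≡2j , hit with parity m
  ...   | odd k  = odd-hit-odd-number k j hit hits≡2j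
  ...   | even k with blocks k
  ...     | misses miss _        = 0≢1+n (trans (sym miss) hit)
  ...     | paired _ hit₂ label≢ = label≢ (begin
    label (o (2 * k))                         ≡⟨ at-hit (2 * k) hit ⟨
    h (hits o (2 * k))                        ≡⟨ cong h hits≡2j ⟩
    h (2 * j)                                 ≡⟨ h2j≡h2j+1 ⟩
    h (suc (2 * j))                           ≡⟨ cong (h ∘ suc) hits≡2j ⟨
    h (suc (hits o (2 * k)))                  ≡⟨ cong (λ i → h (i + hits o (2 * k))) hit ⟨
    h (hits o (suc (2 * k)))                  ≡⟨ at-hit (suc (2 * k)) hit₂ ⟩
    label (o (suc (2 * k)))                   ∎)
    where open IsHitSubsequence hs

module _ {o : ℕ → Out} {g : Seq}
         (blocks : ∀ k → SingleHitBlock (g k) (o (2 * k)) (o (suc (2 * k)))) where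

  hits-singleHitBlocks : ∀ k → hits o (2 * k) ≡ k
  hits-singleHitBlocks zero    = refl
  hits-singleHitBlocks (suc k) = begin
    hits o (2 * suc k)                                             ≡⟨ cong (hits o) (*-suc 2 k) ⟩
    isHit (o (suc (2 * k))) + (isHit (o (2 * k)) + hits o (2 * k)) ≡⟨ +-assoc (isHit (o (suc (2 * k)))) _ _ ⟨
    (isHit (o (suc (2 * k))) + isHit (o (2 * k))) + hits o (2 * k)
      ≡⟨ cong₂ _+_ (one-hit (blocks k)) (hits-singleHitBlocks k) ⟩
    suc k                                                          ∎
    where
    one-hit : ∀ {s a b} → SingleHitBlock s a b → isHit b + isHit a ≡ 1
    one-hit (first hit _ miss)  = cong₂ _+_ miss hit
    one-hit (second miss hit _) = cong₂ _+_ hit miss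

  hitSubsequence-singleHitBlocks : ∀ {h} → IsHitSubsequence o h → ∀ k → h k ≡ g k
  hitSubsequence-singleHitBlocks {h} hs k with blocks k
  ... | first hit label≡ _ = begin
    h k                       ≡⟨ cong h (hits-singleHitBlocks k) ⟨
    h (hits o (2 * k))        ≡⟨ at-hit (2 * k) hit ⟩
    label (o (2 * k))         ≡⟨ label≡ ⟩
    g k                       ∎
    where open IsHitSubsequence hs
  ... | second miss hit label≡ = begin
    h k                       ≡⟨ cong h (hits-singleHitBlocks k) ⟨
    h (hits o (2 * k))        ≡⟨ cong (λ i → h (i + hits o (2 * k))) miss ⟨
    h (hits o (suc (2 * k)))  ≡⟨ at-hit (suc (2 * k)) hit ⟩
    label (o (suc (2 * k)))   ≡⟨ label≡ ⟩
    g k                       ∎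
    where open IsHitSubsequence hs

-- State s1 stands for vertex 2 and target 4, state s2 for vertex 3 and target 5.
target : St → Out
target s1 = hit4
target s2 = hit5

variantAt : Variant → Variant → St → Variant
variantAt X _ s1 = X
variantAt _ Y s2 = Y

hitState : Variant → St
hitState U = s2
hitState D = s1

leave : Variant → Variant → St → St → Out
leave X Y a b = sideMove (variantAt X Y a) (target a) b

-- Round n consists of departures 2n and 2n + 1: from vertex 1 in state r n, and then the
-- (count (r n) r n)-th departure from the vertex this leads to.
roundOut : Variant → Variant → Seq → ℕ → Out
roundOut X Y r n = leave X Y (r n) (r (count (r n) r n))

sideMove-returns : ∀ Z a b → nextPos (sideMove Z (target a) b) ≡ v1
sideMove-returns U a  s1 = refl
sideMove-returns U s1 s2 = refl
sideMove-returns U s2 s2 = refl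
sideMove-returns D s1 s1 = refl
sideMove-returns D s2 s1 = refl
sideMove-returns D a  s2 = refl

module _ (X Y : Variant) (r : Seq) where

  config-even : ∀ n → config X Y r (2 * n) ≡ cfg v1 n (count s1 r n) (count s2 r n)
  config-even zero    = refl
  config-even (suc n) = begin
    config X Y r (2 * suc n)                               ≡⟨ cong (config X Y r) (*-suc 2 n) ⟩
    stepCfg X Y r (stepCfg X Y r (config X Y r (2 * n)))   ≡⟨ cong (stepCfg X Y r ∘ stepCfg X Y r) (config-even n) ⟩
    stepCfg X Y r (stepCfg X Y r (cfg v1 n (count s1 r n) (count s2 r n)))
                                                           ≡⟨ round-returns ⟩
    cfg v1 (suc n) (count s1 r (suc n)) (count s2 r (suc n)) ∎
    where
    round-returns : stepCfg X Y r (stepCfg X Y r (cfg v1 n (count s1 r n) (count s2 r n)))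
                    ≡ cfg v1 (suc n) (count s1 r (suc n)) (count s2 r (suc n))
    round-returns with r n
    ... | s1 = cong (λ v → cfg v (suc n) (suc (count s1 r n)) (count s2 r n)) (sideMove-returns X s1 _)
    ... | s2 = cong (λ v → cfg v (suc n) (count s1 r n) (suc (count s2 r n))) (sideMove-returns Y s2 _)

  out-even-miss : ∀ n → isHit (out X Y r (2 * n)) ≡ 0
  out-even-miss n rewrite config-even n with r n
  ... | s1 = refl
  ... | s2 = refl

  out-odd : ∀ n → out X Y r (suc (2 * n)) ≡ roundOut X Y r n
  out-odd n rewrite config-even n with r n
  ... | s1 = refl
  ... | s2 = refl

  hitsBefore≡hits : ∀ n → hitsBefore X Y r n ≡ hits (out X Y r) n
  hitsBefore≡hits zero = refl
  hitsBefore≡hits (suc n) with out X Y r n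
  ... | go _ = hitsBefore≡hits n
  ... | hit4 = cong suc (hitsBefore≡hits n)
  ... | hit5 = cong suc (hitsBefore≡hits n)

  isHittingSeq-of-rounds : ∀ {h} → IsHitSubsequence (roundOut X Y r) h → IsHittingSeq X Y r h
  isHittingSeq-of-rounds {h} hs = unbounded′ , at-hit′ refl , at-hit′ refl
    where
    open IsHitSubsequence (hitSubsequence-interleave {o′ = out X Y r} hs out-even-miss out-odd)
    unbounded′ : ∀ k → ∃[ n ] k < hitsBefore X Y r n
    unbounded′ k with unbounded k
    ... | n , k<hits = n , subst (k <_) (sym (hitsBefore≡hits n)) k<hits
    at-hit′ : ∀ {x} → isHit x ≡ 1 → ∀ n → out X Y r n ≡ x → h (hitsBefore X Y r n) ≡ label x
    at-hit′ hit n refl = trans (cong h (hitsBefore≡hits n)) (at-hit n hit)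

isHitOf-own : ∀ Z a b → isHitOf a (sideMove Z (target a) b) ≡ δ (hitState Z) b
isHitOf-own U a  s1 = refl
isHitOf-own U s1 s2 = refl
isHitOf-own U s2 s2 = refl
isHitOf-own D s1 s1 = refl
isHitOf-own D s2 s1 = refl
isHitOf-own D a  s2 = refl

isHitOf-other : ∀ Z a b → isHitOf (flip a) (sideMove Z (target a) b) ≡ 0
isHitOf-other U a  s1 = refl
isHitOf-other U s1 s2 = refl
isHitOf-other U s2 s2 = refl
isHitOf-other D s1 s1 = refl
isHitOf-other D s2 s1 = refl
isHitOf-other D a  s2 = refl

hitsOf-roundOut : ∀ X Y r s N →
  hitsOf s (roundOut X Y r) N ≡ count (hitState (variantAt X Y s)) r (count s r N)
hitsOf-roundOut X Y r s zero = refl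
hitsOf-roundOut X Y r s1 (suc N) with r N
... | s1 = trans (cong₂ _+_ (isHitOf-own X s1 _) (hitsOf-roundOut X Y r s1 N))
                 (sym (count-suc (hitState X) r (count s1 r N)))
... | s2 = trans (cong (_+ hitsOf s1 (roundOut X Y r) N) (isHitOf-other Y s2 _))
                 (hitsOf-roundOut X Y r s1 N)
hitsOf-roundOut X Y r s2 (suc N) with r N
... | s1 = trans (cong (_+ hitsOf s2 (roundOut X Y r) N) (isHitOf-other X s1 _))
                 (hitsOf-roundOut X Y r s2 N)
... | s2 = trans (cong₂ _+_ (isHitOf-own Y s2 _) (hitsOf-roundOut X Y r s2 N))
                 (sym (count-suc (hitState Y) r (count s2 r N)))

module _ {r : Seq} {p : ℕ} (rp : Periodic r p) (balanced : count s1 r p ≡ count s2 r p) where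

  private
    c = count s1 r p

    c+c≡p : c + c ≡ p
    c+c≡p = trans (cong (c +_) balanced) (count-s1+count-s2 r p)

    count-period : ∀ s → count s r p ≡ c
    count-period s1 = refl
    count-period s2 = sym balanced

    count-double-period : ∀ s → count s r (p + p) ≡ p
    count-double-period s = begin
      count s r (p + p)          ≡⟨ count-+ rp s p ⟩
      count s r p + count s r p  ≡⟨ cong₂ _+_ (count-period s) (count-period s) ⟩
      c + c                      ≡⟨ c+c≡p ⟩
      p                          ∎

  roundOut-periodic : ∀ X Y → Periodic (roundOut X Y r) (p + p)
  roundOut-periodic X Y n = begin
    roundOut X Y r (p + p + n)
      ≡⟨ cong (λ a → leave X Y a (r (count a r (p + p + n)))) (periodic-+ rp rp n) ⟩
    leave X Y (r n) (r (count (r n) r (p + p + n)))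
      ≡⟨ cong (leave X Y (r n) ∘ r) (count-+ (periodic-+ rp rp) (r n) n) ⟩
    leave X Y (r n) (r (count (r n) r (p + p) + count (r n) r n))
      ≡⟨ cong (λ m → leave X Y (r n) (r (m + count (r n) r n))) (count-double-period (r n)) ⟩
    leave X Y (r n) (r (p + count (r n) r n))
      ≡⟨ cong (leave X Y (r n)) (rp _) ⟩
    roundOut X Y r n
      ∎

  roundOut-hitsOf-period : ∀ X Y s → hitsOf s (roundOut X Y r) (p + p) ≡ c
  roundOut-hitsOf-period X Y s = begin
    hitsOf s (roundOut X Y r) (p + p)           ≡⟨ hitsOf-roundOut X Y r s (p + p) ⟩
    count Z r (count s r (p + p))               ≡⟨ cong (count Z r) (count-double-period s) ⟩
    count Z r p                                 ≡⟨ count-period Z ⟩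
    c                                           ∎
    where Z = hitState (variantAt X Y s)

  roundOut-hits-period : ∀ X Y → hits (roundOut X Y r) (p + p) ≡ p
  roundOut-hits-period X Y = begin
    hits (roundOut X Y r) (p + p)
      ≡⟨ hits-split (p + p) ⟩
    hitsOf s1 (roundOut X Y r) (p + p) + hitsOf s2 (roundOut X Y r) (p + p)
      ≡⟨ cong₂ _+_ (roundOut-hitsOf-period X Y s1) (roundOut-hitsOf-period X Y s2) ⟩
    c + c
      ≡⟨ c+c≡p ⟩
    p ∎

roundOut-balanced : ∀ X Y {r} → Balanced r →
                    ∃[ h ] (IsHitSubsequence (roundOut X Y r) h × Balanced h)
roundOut-balanced X Y {r} (p , ((p>0 , rp) , _) , balanced) =
  h , hs , balanced-of-period (p>0 , h-periodic) (trans (count-h s1) (sym (count-h s2)))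
  where
  o = roundOut X Y r
  o-periodic = roundOut-periodic rp balanced X Y
  hits≡p = roundOut-hits-period rp balanced X Y

  hsub : ∃[ h ] IsHitSubsequence o h
  hsub = hitSubsequence (periodic-hitsUnbounded o-periodic (subst (0 <_) (sym hits≡p) p>0))
  h = proj₁ hsub
  hs = proj₂ hsub

  h-periodic : Periodic h p
  h-periodic = subst (Periodic h) hits≡p (hitSubsequence-periodic hs o-periodic)

  count-h : ∀ s → count s h p ≡ count s1 r p
  count-h s = begin
    count s h p                 ≡⟨ cong (count s h) hits≡p ⟨
    count s h (hits o (p + p))  ≡⟨ count-hitSubsequence hs s (p + p) ⟩
    hitsOf s o (p + p)          ≡⟨ roundOut-hitsOf-period rp balanced X Y s ⟩
    count s1 r p                ∎

module _ {r : Seq} (pairs : AbBaPairs r) (X Y : Variant) where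

  roundOut-even : ∀ k → roundOut X Y r (2 * k) ≡ leave X Y (r (2 * k)) (r k)
  roundOut-even k = cong (leave X Y (r (2 * k)) ∘ r) (count-abBaPairs pairs (r (2 * k)) k)

  roundOut-odd : ∀ k → roundOut X Y r (suc (2 * k)) ≡ leave X Y (flip (r (2 * k))) (r k)
  roundOut-odd k = begin
    leave X Y b (r (count b r (suc (2 * k))))
      ≡⟨ cong (λ t → leave X Y t (r (count t r (suc (2 * k))))) (≢⇒≡flip (pairs k)) ⟩
    leave X Y (flip a) (r (count (flip a) r (suc (2 * k))))
      ≡⟨ cong (leave X Y (flip a) ∘ r) count≡k ⟩
    leave X Y (flip a) (r k)
      ∎
    where
    a = r (2 * k)
    b = r (suc (2 * k))
    count≡k : count (flip a) r (suc (2 * k)) ≡ k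
    count≡k = begin
      count (flip a) r (suc (2 * k))                  ≡⟨ count-suc (flip a) r (2 * k) ⟩
      δ (flip a) a + count (flip a) r (2 * k)
        ≡⟨ cong₂ _+_ (δ-flip-self a) (count-abBaPairs pairs (flip a) k) ⟩
      k                                               ∎

sameBlock : ∀ X a b → PairedBlock (leave X X a b) (leave X X (flip a) b)
sameBlock U s1 s1 = misses refl refl
sameBlock U s1 s2 = paired refl refl λ ()
sameBlock U s2 s1 = misses refl refl
sameBlock U s2 s2 = paired refl refl λ ()
sameBlock D s1 s1 = paired refl refl λ ()
sameBlock D s1 s2 = misses refl refl
sameBlock D s2 s1 = paired refl refl λ ()
sameBlock D s2 s2 = misses refl refl

opposite : Variant → Variant
opposite U = D
opposite D = U

sameOrOpposite : ∀ X Y → Y ≡ X ⊎ Y ≡ opposite X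
sameOrOpposite U U = inj₁ refl
sameOrOpposite U D = inj₂ refl
sameOrOpposite D U = inj₂ refl
sameOrOpposite D D = inj₁ refl

mixedLabel : Variant → St → St
mixedLabel U b = flip b
mixedLabel D b = b

mixedLabel-injective : ∀ X {a b} → mixedLabel X a ≡ mixedLabel X b → a ≡ b
mixedLabel-injective U {s1} {s1} _ = refl
mixedLabel-injective U {s2} {s2} _ = refl
mixedLabel-injective D eq = eq

mixedBlock : ∀ X a b → SingleHitBlock (mixedLabel X b) (leave X (opposite X) a b)
                                                       (leave X (opposite X) (flip a) b)
mixedBlock U s1 s1 = second refl refl refl
mixedBlock U s1 s2 = first refl refl refl
mixedBlock U s2 s1 = first refl refl refl
mixedBlock U s2 s2 = second refl refl refl
mixedBlock D s1 s1 = first refl refl refl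
mixedBlock D s1 s2 = second refl refl refl
mixedBlock D s2 s1 = second refl refl refl
mixedBlock D s2 s2 = first refl refl refl

roundOut-abBaPairs : ∀ X Y {r h} → AbBaPairs r → IsHitSubsequence (roundOut X Y r) h → AbBaPairs h
roundOut-abBaPairs X Y {r} {h} pairs hs with sameOrOpposite X Y
... | inj₁ refl = abBaPairs-of-pairedBlocks blocks hs
  where
  blocks : ∀ k → PairedBlock (roundOut X X r (2 * k)) (roundOut X X r (suc (2 * k)))
  blocks k = subst₂ PairedBlock (sym (roundOut-even {r} pairs X X k)) (sym (roundOut-odd {r} pairs X X k))
                    (sameBlock X (r (2 * k)) (r k))
... | inj₂ refl = λ j h2j≡h2j+1 → pairs j (mixedLabel-injective X (begin
    mixedLabel X (r (2 * j))        ≡⟨ h≡mixedLabel (2 * j) ⟨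
    h (2 * j)                       ≡⟨ h2j≡h2j+1 ⟩
    h (suc (2 * j))                 ≡⟨ h≡mixedLabel (suc (2 * j)) ⟩
    mixedLabel X (r (suc (2 * j)))  ∎))
  where
  blocks : ∀ k → SingleHitBlock (mixedLabel X (r k)) (roundOut X (opposite X) r (2 * k))
                                                    (roundOut X (opposite X) r (suc (2 * k)))
  blocks k = subst₂ (SingleHitBlock _) (sym (roundOut-even {r} pairs X _ k)) (sym (roundOut-odd {r} pairs X _ k))
                    (mixedBlock X (r (2 * k)) (r k))
  h≡mixedLabel : ∀ k → h k ≡ mixedLabel X (r k)
  h≡mixedLabel = hitSubsequence-singleHitBlocks blocks hs

corollary7p3 : (X Y : Variant) (r : Seq) → r 0 ≡ s1 →
    ((Balanced r → ∃[ h ] (IsHittingSeq X Y r h × Balanced h))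
     × (AbBa r → ∃[ h ] (IsHittingSeq X Y r h × AbBa h)))
-- The hypothesis r 0 ≡ s1 is only the paper's naming convention.
corollary7p3 X Y r _ = closed-balanced , closed-abBa
  where
  closed-balanced : Balanced r → ∃[ h ] (IsHittingSeq X Y r h × Balanced h)
  closed-balanced balanced =
    let h , hs , h-balanced = roundOut-balanced X Y balanced
    in  h , isHittingSeq-of-rounds X Y r hs , h-balanced

  closed-abBa : AbBa r → ∃[ h ] (IsHittingSeq X Y r h × AbBa h)
  closed-abBa abBa@(_ , _ , _ , pairs) =
    let h , hs , h-balanced = roundOut-balanced X Y (balanced-of-abBa abBa)
    in  h , isHittingSeq-of-rounds X Y r hs , abBa-of-balanced h-balanced (roundOut-abBaPairs X Y {r} pairs hs)
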